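{- Let $\mathbf{Q}$ be a quantale, $X$ a non-empty set, $Y$ a non-empty subset of $X$, and $p\in Q^{X\times Y}$ a coder, i.e. $e\le p(y,y)$ for all $y\in Y$. Let $H_p:Q^X\to Q^Y$, $H_pf(y)=\bigvee_{x\in X}f(x)\cdot p(x,y)$. Then, for any fixed $y\in Y$, $H_pf(y)=f(y)$ for all $f\in Q^X$ if and only if $p(x,y)=e$ for $x=y$ and $p(x,y)=\bot$ for all $x\in X$ with $x\neq y$.
   Context: A quantale is $\mathbf{Q}=\langle Q,\vee,\cdot,\bot,e\rangle$ with $\langle Q,\vee,\bot\rangle$ a complete lattice, $\langle Q,\cdot,e\rangle$ a monoid, and multiplication distributing over arbitrary joins on both sides. In general a coder is $p\in Q^{X\times Y}$ admitting an injective $\varepsilon:Y\to X$ with $e\le p(\varepsilon(y),y)$; here, as a standing convention of the paper, $Y\subseteq X$ and $\varepsilon$ is the inclusion map. -}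

module Defs where

open import Level using (Level; _⊔_; Lift) renaming (suc to lsuc)
open import Data.Empty using (⊥)
open import Data.Product using (Σ; proj₁; _×_)
open import Relation.Nullary using (¬_)
open import Relation.Binary.PropositionalEquality using (_≡_)

record Quantale (c i : Level) : Set (lsuc (c ⊔ i)) where
  infix  4 _≤_
  infixl 7 _·_
  field
    Carrier   : Set c
    _≤_       : Carrier → Carrier → Set c
    ≤-refl    : ∀ {a} → a ≤ a
    ≤-trans   : ∀ {a b d} → a ≤ b → b ≤ d → a ≤ d
    ≤-antisym : ∀ {a b} → a ≤ b → b ≤ a → a ≡ b
    ⋁         : {I : Set i} → (I → Carrier) → Carrier
    ⋁-upper   : {I : Set i} (f : I → Carrier) (j : I) → f j ≤ ⋁ f
    ⋁-least   : {I : Set i} (f : I → Carrier) (u : Carrier) →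
                (∀ j → f j ≤ u) → ⋁ f ≤ u
    _·_       : Carrier → Carrier → Carrier
    e         : Carrier
    ·-assoc   : ∀ a b d → (a · b) · d ≡ a · (b · d)
    ·-identityˡ : ∀ a → e · a ≡ a
    ·-identityʳ : ∀ a → a · e ≡ a
    ·-distribˡ-⋁ : ∀ a {I : Set i} (f : I → Carrier) → a · ⋁ f ≡ ⋁ (λ j → a · f j)
    ·-distribʳ-⋁ : ∀ a {I : Set i} (f : I → Carrier) → ⋁ f · a ≡ ⋁ (λ j → f j · a)

  ⊥Q : Carrier
  ⊥Q = ⋁ {Lift i ⊥} (λ ())

  _∨_ : Carrier → Carrier → Carrier
  a ∨ b = ⋁ {Lift i Data.Bool.Bool} (λ { (Level.lift Data.Bool.true) → a ; (Level.lift Data.Bool.false) → b })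
    where import Data.Bool

module _ {c i : Level} (Q : Quantale c i) where
  open Quantale Q

  -- Y ⊆ X is given as a predicate Y on X; its elements are Σ X Y,
  -- and the inclusion ε is proj₁.
  -- p ∈ Q^{X×Y} is a coder: e ≤ p(y,y) for all y ∈ Y.
  IsCoder : (X : Set i) (Y : X → Set i) → (X → Σ X Y → Carrier) → Set (c ⊔ i)
  IsCoder X Y p = ∀ (y : Σ X Y) → e ≤ p (proj₁ y) y

  H : {X : Set i} {Y : X → Set i} → (X → Σ X Y → Carrier) →
      (X → Carrier) → Σ X Y → Carrier
  H {X} p f y = ⋁ {X} (λ x → f x · p x y)

-- Only the column q x := p(x,y) matters, and H_p f(y) = ⋁ₓ f(x)·q(x).  With
-- excluded middle, a join whose terms vanish off one index x₀ is its x₀-th term.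
-- This gives the converse at once, and applied to the indicator f = δₓ (e at x,
-- ⊥ elsewhere) it shows q(x) = H_p δₓ(y) = δₓ(y), which is the forward direction.
module Submission where

open import Defs
open import Level using (Level; lift)
open import Axiom.ExcludedMiddle using (ExcludedMiddle)
open import Data.Empty using (⊥-elim)
open import Data.Product using (Σ; proj₁; _×_; _,_)
open import Relation.Nullary using (¬_; yes; no)
open import Relation.Binary.PropositionalEquality
  using (_≡_; refl; sym; trans; cong; module ≡-Reasoning)
open import Function.Bundles using (_⇔_; mk⇔)

module QuantaleProperties {c i : Level} (Q : Quantale c i) where
  open Quantale Q

  ≤-reflexive : ∀ {a b} → a ≡ b → a ≤ b
  ≤-reflexive refl = ≤-refl

  ⊥Q-minimum : ∀ a → ⊥Q ≤ a
  ⊥Q-minimum a = ⋁-least _ a (λ { (lift ()) })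

  ·-zeroˡ : ∀ a → ⊥Q · a ≡ ⊥Q
  ·-zeroˡ a = ≤-antisym
    (≤-trans (≤-reflexive (·-distribʳ-⋁ a _)) (⋁-least _ ⊥Q (λ { (lift ()) })))
    (⊥Q-minimum _)

  ·-zeroʳ : ∀ a → a · ⊥Q ≡ ⊥Q
  ·-zeroʳ a = ≤-antisym
    (≤-trans (≤-reflexive (·-distribˡ-⋁ a _)) (⋁-least _ ⊥Q (λ { (lift ()) })))
    (⊥Q-minimum _)

  module _ (em : ExcludedMiddle i) {X : Set i} where

    ⋁-concentrated : (x₀ : X) (f : X → Carrier) →
                     (∀ x → ¬ x ≡ x₀ → f x ≡ ⊥Q) → ⋁ f ≡ f x₀
    ⋁-concentrated x₀ f vanish = ≤-antisym (⋁-least f (f x₀) bound) (⋁-upper f x₀)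
      where
      bound : ∀ x → f x ≤ f x₀
      bound x with em {x ≡ x₀}
      ... | yes refl = ≤-refl
      ... | no x≢x₀  = ≤-trans (≤-reflexive (vanish x x≢x₀)) (⊥Q-minimum _)

    δ : X → X → Carrier
    δ x₀ x with em {x ≡ x₀}
    ... | yes _ = e
    ... | no _  = ⊥Q

    δ-self : ∀ x₀ → δ x₀ x₀ ≡ e
    δ-self x₀ with em {x₀ ≡ x₀}
    ... | yes _   = refl
    ... | no x₀≢x₀ = ⊥-elim (x₀≢x₀ refl)

    δ-other : ∀ x₀ x → ¬ x ≡ x₀ → δ x₀ x ≡ ⊥Q
    δ-other x₀ x x≢x₀ with em {x ≡ x₀}
    ... | yes x≡x₀ = ⊥-elim (x≢x₀ x≡x₀)
    ... | no _     = refl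

    ⋁-δ-· : ∀ x₀ (q : X → Carrier) → ⋁ (λ x → δ x₀ x · q x) ≡ q x₀
    ⋁-δ-· x₀ q = begin
      ⋁ (λ x → δ x₀ x · q x)
        ≡⟨ ⋁-concentrated x₀ _ (λ x x≢x₀ → trans (cong (_· q x) (δ-other x₀ x x≢x₀)) (·-zeroˡ (q x))) ⟩
      δ x₀ x₀ · q x₀
        ≡⟨ cong (_· q x₀) (δ-self x₀) ⟩
      e · q x₀
        ≡⟨ ·-identityˡ (q x₀) ⟩
      q x₀ ∎
      where open ≡-Reasoning

    ⋁-·-evaluates⇔δ : (x₀ : X) (q : X → Carrier) →
      (∀ f → ⋁ (λ x → f x · q x) ≡ f x₀) ⇔ ((q x₀ ≡ e) × (∀ x → ¬ x ≡ x₀ → q x ≡ ⊥Q))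
    ⋁-·-evaluates⇔δ x₀ q = mk⇔ to from
      where
      q≡δ : (∀ f → ⋁ (λ x → f x · q x) ≡ f x₀) → ∀ x → q x ≡ δ x x₀
      q≡δ evaluates x = trans (sym (⋁-δ-· x q)) (evaluates (δ x))

      to : (∀ f → ⋁ (λ x → f x · q x) ≡ f x₀) → (q x₀ ≡ e) × (∀ x → ¬ x ≡ x₀ → q x ≡ ⊥Q)
      to evaluates = trans (q≡δ evaluates x₀) (δ-self x₀)
                   , λ x x≢x₀ → trans (q≡δ evaluates x) (δ-other x x₀ (λ x₀≡x → x≢x₀ (sym x₀≡x)))

      from : (q x₀ ≡ e) × (∀ x → ¬ x ≡ x₀ → q x ≡ ⊥Q) → ∀ f → ⋁ (λ x → f x · q x) ≡ f x₀
      from (q≡e , q≡⊥) f = begin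
        ⋁ (λ x → f x · q x)
          ≡⟨ ⋁-concentrated x₀ _ (λ x x≢x₀ → trans (cong (f x ·_) (q≡⊥ x x≢x₀)) (·-zeroʳ (f x))) ⟩
        f x₀ · q x₀
          ≡⟨ cong (f x₀ ·_) q≡e ⟩
        f x₀ · e
          ≡⟨ ·-identityʳ (f x₀) ⟩
        f x₀ ∎
        where open ≡-Reasoning

lemma5p14 : {c i : Level} → ExcludedMiddle i → (Q : Quantale c i) →
    (X : Set i) → X → (Y : X → Set i) → Σ X Y →
    (p : X → Σ X Y → Quantale.Carrier Q) → IsCoder Q X Y p →
    (y : Σ X Y) →
      ((∀ (f : X → Quantale.Carrier Q) → H Q p f y ≡ f (proj₁ y))
       ⇔ ((p (proj₁ y) y ≡ Quantale.e Q)
          × (∀ (x : X) → ¬ (x ≡ proj₁ y) → p x y ≡ Quantale.⊥Q Q)))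
lemma5p14 em Q _ _ _ _ p _ y =
  QuantaleProperties.⋁-·-evaluates⇔δ Q em (proj₁ y) (λ x → p x y)
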